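{- Let $G$ be a graph and $v_0 \in V(G)$. The projection of $P(G)$ onto the coordinates indexed by $V(G - v_0)$ equals $P(G - v_0)$, where for a graph $H$, $P(H) := \operatorname{conv}\{x \in \mathbb{Z}^{V(H)} \mid x(u)+x(v) \le 1 \ \forall uv \in E(H)\}$.
   Context: All graphs are finite, simple and undirected.
   Formalization: The sets $P(G)$ and $P(G - v_0)$ are taken over ℚ: their points have rational coordinates and are convex combinations with rational weights. -}

module Defs where

open import Level using (0ℓ)
open import Data.Nat using (ℕ; suc)
open import Data.Fin using (Fin; punchIn)
open import Data.Integer as ℤ using (ℤ)
open import Data.Rational using (ℚ; _/_; _+_; _*_; _≤_; 0ℚ; 1ℚ)
open import Data.List using (List; []; _∷_)
open import Data.List.Relation.Unary.All using (All)
open import Data.Product using (Σ; _×_; _,_; proj₁; proj₂; ∃)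
open import Relation.Nullary using (¬_)
open import Relation.Binary.PropositionalEquality using (_≡_)

record Graph (n : ℕ) : Set₁ where
  field
    Adj     : Fin n → Fin n → Set
    symm    : ∀ {u v} → Adj u v → Adj v u
    irrefl  : ∀ {u} → ¬ Adj u u
open Graph public

-- G - v0 : delete vertex v0; the remaining vertices are identified with
-- Fin n via punchIn v0.
_─_ : ∀ {n} → Graph (suc n) → Fin (suc n) → Graph n
Adj    (G ─ v0) i j = Adj G (punchIn v0 i) (punchIn v0 j)
symm   (G ─ v0) a   = symm G a
irrefl (G ─ v0) a   = irrefl G a

Feasible : ∀ {n} → Graph n → (Fin n → ℤ) → Set
Feasible H z = ∀ u v → Adj H u v → z u ℤ.+ z v ℤ.≤ ℤ.+ 1

toℚ : ℤ → ℚ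
toℚ z = z / 1

weightSum : ∀ {n} → List (ℚ × (Fin n → ℤ)) → ℚ
weightSum []             = 0ℚ
weightSum ((l , _) ∷ ps) = l + weightSum ps

combo : ∀ {n} → List (ℚ × (Fin n → ℤ)) → Fin n → ℚ
combo []             i = 0ℚ
combo ((l , z) ∷ ps) i = l * toℚ (z i) + combo ps i

InConv : ∀ {n} → ((Fin n → ℤ) → Set) → (Fin n → ℚ) → Set
InConv {n} S x =
  Σ (List (ℚ × (Fin n → ℤ))) λ ps →
    All (λ p → (0ℚ ≤ proj₁ p) × S (proj₂ p)) ps
    × weightSum ps ≡ 1ℚ
    × (∀ i → combo ps i ≡ x i)

-- (rational points of) P(H) = conv{x ∈ ℤ^{V(H)} | x(u)+x(v) ≤ 1 ∀ uv ∈ E(H)}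
InP : ∀ {n} → Graph n → (Fin n → ℚ) → Set
InP H = InConv (Feasible H)

-- Restricting a feasible point of G to V(G − v0) keeps it feasible, so projecting a
-- convex combination of feasible points of G gives one for G − v0. Conversely, a
-- feasible point of G − v0 becomes feasible for G once v0 gets a small enough value;
-- extending every point of a convex combination this way lifts it along the projection.
module Submission where

open import Defs
open import Data.Nat using (ℕ; suc)
open import Data.Fin using (Fin; punchIn; punchOut; _≟_)
open import Data.Fin.Properties using (punchIn-punchOut)
open import Data.Vec.Functional using (insertAt; foldr)
open import Data.Vec.Functional.Properties using (insertAt-lookup; insertAt-punchIn)
open import Data.Integer as ℤ using (ℤ; 0ℤ; 1ℤ; _⊔_)
import Data.Integer.Properties as ℤ
open import Algebra.Properties.AbelianGroup ℤ.+-0-abelianGroup using (//-rightDividesˡ)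
open import Data.Rational using (ℚ; 0ℚ; _≤_) renaming (_+_ to _+ℚ_; _*_ to _*ℚ_)
open import Data.List using (List; []; _∷_; map)
open import Data.List.Relation.Unary.All as All using (All)
open import Data.List.Relation.Unary.All.Properties using (map⁺)
open import Data.Product using (Σ; _×_; _,_; proj₁; proj₂; map₂)
open import Data.Empty using (⊥-elim)
open import Function using (_∘_)
open import Relation.Nullary using (yes; no)
open import Relation.Binary.PropositionalEquality

mapPoints : ∀ {m k} → ((Fin m → ℤ) → Fin k → ℤ) →
            List (ℚ × (Fin m → ℤ)) → List (ℚ × (Fin k → ℤ))
mapPoints f = map (map₂ f)

weightSum-mapPoints : ∀ {m k} {f : (Fin m → ℤ) → Fin k → ℤ} ps →
                      weightSum (mapPoints f ps) ≡ weightSum ps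
weightSum-mapPoints []             = refl
weightSum-mapPoints ((l , _) ∷ ps) = cong (l +ℚ_) (weightSum-mapPoints ps)

combo-mapPoints : ∀ {m k} {f : (Fin m → ℤ) → Fin k → ℤ} {j i} ps →
                  (∀ z → f z j ≡ z i) → combo (mapPoints f ps) j ≡ combo ps i
combo-mapPoints []             fj≡i = refl
combo-mapPoints ((l , z) ∷ ps) fj≡i =
  cong₂ (λ a b → l *ℚ toℚ a +ℚ b) (fj≡i z) (combo-mapPoints ps fj≡i)

WeightedIn : ∀ {m} → ((Fin m → ℤ) → Set) → List (ℚ × (Fin m → ℤ)) → Set
WeightedIn S = All (λ p → (0ℚ ≤ proj₁ p) × S (proj₂ p))

weightedIn-mapPoints : ∀ {m k} {S : (Fin m → ℤ) → Set} {T : (Fin k → ℤ) → Set}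
                       {f : (Fin m → ℤ) → Fin k → ℤ} {ps} →
                       (∀ z → S z → T (f z)) → WeightedIn S ps → WeightedIn T (mapPoints f ps)
weightedIn-mapPoints S⇒T = map⁺ ∘ All.map (λ {(_ , z)} → map₂ (S⇒T z))

InConv-reindex : ∀ {m k} {S : (Fin m → ℤ) → Set} {T : (Fin k → ℤ) → Set} {x}
                 (σ : Fin k → Fin m) → (∀ z → S z → T (z ∘ σ)) →
                 InConv S x → InConv T (x ∘ σ)
InConv-reindex σ S⇒T (ps , weighted , total , combo≡x) =
  mapPoints (_∘ σ) ps , weightedIn-mapPoints S⇒T weighted ,
  trans (weightSum-mapPoints ps) total ,
  λ j → trans (combo-mapPoints ps (λ _ → refl)) (combo≡x (σ j))

InConv-lift : ∀ {m k} {S : (Fin k → ℤ) → Set} {T : (Fin m → ℤ) → Set} {y}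
              (σ : Fin k → Fin m) (f : (Fin k → ℤ) → Fin m → ℤ) →
              (∀ z i → f z (σ i) ≡ z i) → (∀ z → S z → T (f z)) →
              InConv S y → Σ (Fin m → ℚ) λ x → InConv T x × (∀ i → x (σ i) ≡ y i)
InConv-lift σ f f∘σ≗id S⇒T (ps , weighted , total , combo≡y) =
  combo (mapPoints f ps) ,
  (mapPoints f ps , weightedIn-mapPoints S⇒T weighted ,
   trans (weightSum-mapPoints ps) total , λ _ → refl) ,
  λ i → trans (combo-mapPoints ps (λ z → f∘σ≗id z i)) (combo≡y i)

feasible-restrict : ∀ {n} (G : Graph (suc n)) v z →
                    Feasible G z → Feasible (G ─ v) (z ∘ punchIn v)
feasible-restrict G v z feasible u w = feasible (punchIn v u) (punchIn v w)

insertAt-punchOut : ∀ {n} {A : Set} (z : Fin n → A) {v u} c (v≢u : v ≢ u) →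
                    insertAt z v c u ≡ z (punchOut v≢u)
insertAt-punchOut z {v} c v≢u =
  trans (cong (insertAt z v c) (sym (punchIn-punchOut v≢u))) (insertAt-punchIn z v c _)

feasible-insertAt : ∀ {n} (G : Graph (suc n)) v {z c} →
                    Feasible (G ─ v) z → (∀ i → c ℤ.+ z i ℤ.≤ 1ℤ) →
                    Feasible G (insertAt z v c)
feasible-insertAt G v {z} {c} feasible c+z≤1 u w uw with v ≟ u | v ≟ w
... | yes refl | yes refl = ⊥-elim (irrefl G uw)
... | yes refl | no v≢w
  rewrite insertAt-lookup z v c | insertAt-punchOut z c v≢w = c+z≤1 _
... | no v≢u   | yes refl
  rewrite insertAt-lookup z v c | insertAt-punchOut z c v≢u =
    subst (ℤ._≤ 1ℤ) (ℤ.+-comm c _) (c+z≤1 _)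
... | no v≢u   | no v≢w
  rewrite insertAt-punchOut z c v≢u | insertAt-punchOut z c v≢w =
    feasible _ _ (subst₂ (Adj G) (sym (punchIn-punchOut v≢u)) (sym (punchIn-punchOut v≢w)) uw)

upperBound : ∀ {n} → (Fin n → ℤ) → ℤ
upperBound = foldr _⊔_ 0ℤ

≤-upperBound : ∀ {n} (z : Fin n → ℤ) i → z i ℤ.≤ upperBound z
≤-upperBound z Fin.zero    = ℤ.i≤i⊔j _ _
≤-upperBound z (Fin.suc i) = ℤ.i≤j⇒i≤k⊔j (z Fin.zero) (≤-upperBound (z ∘ Fin.suc) i)

-- Feasible points may have negative entries, so v cannot simply get 0;
-- 1 - max z keeps every edge at v feasible.
extend : ∀ {n} → Fin (suc n) → (Fin n → ℤ) → Fin (suc n) → ℤ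
extend v z = insertAt z v (1ℤ ℤ.- upperBound z)

feasible-extend : ∀ {n} (G : Graph (suc n)) v z →
                  Feasible (G ─ v) z → Feasible G (extend v z)
feasible-extend G v z feasible = feasible-insertAt G v feasible c+z≤1
  where
  c+z≤1 : ∀ i → (1ℤ ℤ.- upperBound z) ℤ.+ z i ℤ.≤ 1ℤ
  c+z≤1 i = ℤ.≤-trans (ℤ.+-monoʳ-≤ (1ℤ ℤ.- upperBound z) (≤-upperBound z i))
                      (ℤ.≤-reflexive (//-rightDividesˡ (upperBound z) 1ℤ))

lemma12p2 : (n : ℕ) (G : Graph (suc n)) (v0 : Fin (suc n)) →
    ((x : Fin (suc n) → ℚ) → InP G x → InP (G ─ v0) (λ i → x (punchIn v0 i)))
    × ((y : Fin n → ℚ) → InP (G ─ v0) y →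
        Σ (Fin (suc n) → ℚ) λ x → InP G x × (∀ i → x (punchIn v0 i) ≡ y i))
lemma12p2 n G v0 =
  (λ x → InConv-reindex (punchIn v0) (feasible-restrict G v0)) ,
  (λ y → InConv-lift (punchIn v0) (extend v0) (λ z → insertAt-punchIn z v0 _)
                     (feasible-extend G v0))
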